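{- For every integer $a\ge 2$, $$ n(a,a+2,a+3,a+4)=\begin{cases} \dfrac{a^2+4 a+8}{8}&\text{if } a\equiv 0\pmod 4,\\ \dfrac{a^2+4 a+3}{8}&\text{if } a\equiv 1\pmod 4,\\ \dfrac{a^2+4 a+4}{8}&\text{if } a\equiv 2\pmod 4,\\ \dfrac{a^2+4 a+3}{8}&\text{if } a\equiv 3\pmod 4. \end{cases} $$
   Context: For positive integers $a_1,\dots,a_m$ with $\gcd(a_1,\dots,a_m)=1$, the Sylvester number $n(a_1,\dots,a_m)$ is the number of positive integers that cannot be written as $x_1a_1+\cdots+x_ma_m$ with nonnegative integers $x_i$. -}

module Defs where

open import Data.Nat using (ℕ; _*_; _≤_)
open import Data.Vec using (Vec; zipWith; sum)
open import Data.List using (List; length)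
open import Data.List.Membership.Propositional using (_∈_)
open import Data.List.Relation.Unary.Unique.Propositional using (Unique)
open import Data.Product using (Σ; ∃-syntax; _×_)
open import Relation.Nullary using (¬_)
open import Relation.Binary.PropositionalEquality using (_≡_)

Representable : ∀ {m} → Vec ℕ m → ℕ → Set
Representable {m} as n = Σ (Vec ℕ m) (λ xs → sum (zipWith _*_ xs as) ≡ n)

SylvesterNumberIs : ∀ {m} → Vec ℕ m → ℕ → Set
SylvesterNumberIs as k =
  ∃[ L ] (Unique L × length L ≡ k ×
          (∀ n → (n ∈ L → (1 ≤ n × ¬ Representable as n))
               × ((1 ≤ n × ¬ Representable as n) → n ∈ L)))

-- Write x₁a + x₂(a + 2) + x₃(a + 3) + x₄(a + 4) as j·a + s with j = Σ xᵢ and s = 2x₂ + 3x₃ + 4x₄;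
-- for a fixed number j of summands the possible s are exactly 0 and 2, …, 4j.  A representation of
-- n = q·a + r (r < a) uses j ≤ q summands and s = (q - j)·a + r, so n is a gap iff 4q < r, or
-- r = 1 and (q - 1)·a + (a + 1) is out of reach, i.e. 4q ≤ a + 4.  Listed level by level, level 0
-- has a - 1 gaps and each level 1 ≤ q ≤ ⌊a/4⌋ + 1 has 1 + max(0, a - 4q - 1); summing this gives
-- the stated quadratic in each residue class of a modulo 4.
module Submission where

open import Defs
open import Data.Nat using (ℕ; zero; suc; _+_; _*_; _∸_; _≤_; _<_; _%_; _/_; z≤n; s≤s; _≤?_; _<?_; _≟_; NonZero; >-nonZero)
open import Data.Nat.Properties
open import Data.Nat.DivMod using (m≡m%n+[m/n]*n; m%n<n; m/n*n≤m; m*n/n≡m)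
open import Data.Nat.Tactic.RingSolver using (solve-∀)
open import Data.Vec using (Vec; []; _∷_; sum; zipWith)
open import Data.List using (List; []; _∷_; _++_; map; length; applyUpTo)
open import Data.List.Properties using (length-++; length-map; length-applyUpTo)
open import Data.List.Membership.Propositional using (_∈_)
open import Data.List.Membership.Propositional.Properties using (∈-applyUpTo⁺; ∈-applyUpTo⁻; ∈-map⁺; ∈-map⁻; ∈-++⁺ˡ; ∈-++⁺ʳ; ∈-++⁻)
open import Data.List.Relation.Unary.Any using (here; there)
import Data.List.Relation.Unary.All as All
import Data.List.Relation.Unary.All.Properties as All
import Data.List.Relation.Unary.AllPairs as AllPairs
open import Data.List.Relation.Unary.AllPairs using (AllPairs; []; _∷_)
import Data.List.Relation.Unary.AllPairs.Properties as AllPairs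
open import Data.Product using (_×_; _,_; proj₂; ∃-syntax)
open import Data.Sum using (inj₁; inj₂)
open import Data.Empty using (⊥)
open import Function using (_∘_)
open import Relation.Nullary using (¬_; yes; no; contradiction)
open import Relation.Binary.PropositionalEquality using (_≡_; _≢_; refl; sym; trans; cong; subst; subst₂; cong₂; module ≡-Reasoning)

infix 7 _·_

_·_ : ∀ {n} → Vec ℕ n → Vec ℕ n → ℕ
xs · ys = sum (zipWith _*_ xs ys)

generators : ℕ → Vec ℕ 4
generators a = a ∷ a + 2 ∷ a + 3 ∷ a + 4 ∷ []

weights : Vec ℕ 4
weights = 0 ∷ 2 ∷ 3 ∷ 4 ∷ []

·-generators : ∀ a xs → xs · generators a ≡ sum xs * a + xs · weights
·-generators a (x₁ ∷ x₂ ∷ x₃ ∷ x₄ ∷ []) = expand x₁ x₂ x₃ x₄ a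
  where
  expand : ∀ x₁ x₂ x₃ x₄ a →
    x₁ * a + (x₂ * (a + 2) + (x₃ * (a + 3) + (x₄ * (a + 4) + 0)))
      ≡ (x₁ + (x₂ + (x₃ + (x₄ + 0)))) * a + (x₁ * 0 + (x₂ * 2 + (x₃ * 3 + (x₄ * 4 + 0))))
  expand = solve-∀

data Attainable (j : ℕ) : ℕ → Set where
  none    : Attainable j 0
  between : ∀ {s} → 2 ≤ s → s ≤ 4 * j → Attainable j s

attainable⇒≤ : ∀ {j s} → Attainable j s → s ≤ 4 * j
attainable⇒≤ none = z≤n
attainable⇒≤ (between _ s≤4j) = s≤4j

attainable⇒≢1 : ∀ {j s} → Attainable j s → s ≢ 1
attainable⇒≢1 none ()
attainable⇒≢1 (between (s≤s (s≤s _)) _) ()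

·weights≤4*sum : ∀ xs → xs · weights ≤ 4 * sum xs
·weights≤4*sum (x₁ ∷ x₂ ∷ x₃ ∷ x₄ ∷ []) =
  ≤-trans (m≤m+n _ (x₁ * 4 + x₂ * 2 + x₃)) (≤-reflexive (sym (split x₁ x₂ x₃ x₄)))
  where
  split : ∀ x₁ x₂ x₃ x₄ →
    4 * (x₁ + (x₂ + (x₃ + (x₄ + 0))))
      ≡ (x₁ * 0 + (x₂ * 2 + (x₃ * 3 + (x₄ * 4 + 0)))) + (x₁ * 4 + x₂ * 2 + x₃)
  split = solve-∀

·weights-attainable : ∀ xs → Attainable (sum xs) (xs · weights)
·weights-attainable (x₁ ∷ zero ∷ zero ∷ zero ∷ []) rewrite *-zeroʳ x₁ = none
·weights-attainable xs@(x₁ ∷ suc _ ∷ _ ∷ _ ∷ []) =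
  between (≤-trans (m≤m+n 2 _) (m≤n+m _ (x₁ * 0))) (·weights≤4*sum xs)
·weights-attainable xs@(x₁ ∷ zero ∷ suc _ ∷ _ ∷ []) =
  between (≤-trans (m≤m+n 2 _) (m≤n+m _ (x₁ * 0))) (·weights≤4*sum xs)
·weights-attainable xs@(x₁ ∷ zero ∷ zero ∷ suc _ ∷ []) =
  between (≤-trans (m≤m+n 2 _) (m≤n+m _ (x₁ * 0))) (·weights≤4*sum xs)

SumOfWeights : ℕ → ℕ → Set
SumOfWeights j s = ∃[ xs ] sum xs ≡ j × xs · weights ≡ s

top-sumOfWeights : ∀ j o → o ≤ 3 → 2 ≤ suc (4 * j) + o → SumOfWeights (suc j) (suc (4 * j) + o)
top-sumOfWeights zero 0 _ (s≤s ())
top-sumOfWeights (suc j) 0 _ _ = (0 ∷ 1 ∷ 1 ∷ j ∷ []) , cong (2 +_) (+-identityʳ j) , value j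
  where
  value : ∀ j → 0 * 0 + (1 * 2 + (1 * 3 + (j * 4 + 0))) ≡ suc (4 * suc j) + 0
  value = solve-∀
top-sumOfWeights j 1 _ _ = (0 ∷ 1 ∷ 0 ∷ j ∷ []) , cong suc (+-identityʳ j) , value j
  where
  value : ∀ j → 0 * 0 + (1 * 2 + (0 * 3 + (j * 4 + 0))) ≡ suc (4 * j) + 1
  value = solve-∀
top-sumOfWeights j 2 _ _ = (0 ∷ 0 ∷ 1 ∷ j ∷ []) , cong suc (+-identityʳ j) , value j
  where
  value : ∀ j → 0 * 0 + (0 * 2 + (1 * 3 + (j * 4 + 0))) ≡ suc (4 * j) + 2
  value = solve-∀
top-sumOfWeights j 3 _ _ = (0 ∷ 0 ∷ 0 ∷ suc j ∷ []) , cong suc (+-identityʳ j) , value j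
  where
  value : ∀ j → 0 * 0 + (0 * 2 + (0 * 3 + (suc j * 4 + 0))) ≡ suc (4 * j) + 3
  value = solve-∀
top-sumOfWeights j (suc (suc (suc (suc _)))) (s≤s (s≤s (s≤s ()))) _

interval-sumOfWeights : ∀ j s → 2 ≤ s → s ≤ 4 * j → SumOfWeights j s
interval-sumOfWeights zero s 2≤s s≤0 = contradiction (≤-trans 2≤s s≤0) λ ()
interval-sumOfWeights (suc j) s 2≤s s≤4[1+j] with s ≤? 4 * j
... | yes s≤4j with x₁ ∷ rest , refl , refl ← interval-sumOfWeights j s 2≤s s≤4j =
  suc x₁ ∷ rest , refl , refl
... | no s≰4j with o , refl ← m≤n⇒∃[o]m+o≡n (≰⇒> s≰4j) =
  top-sumOfWeights j o (≤-pred (+-cancelˡ-≤ (4 * j) _ _ bound)) 2≤s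
  where
  bound : 4 * j + suc o ≤ 4 * j + 4
  bound = subst₂ _≤_ (sym (+-suc (4 * j) o)) (trans (*-suc 4 j) (+-comm 4 (4 * j))) s≤4[1+j]

attainable⇒sumOfWeights : ∀ {j s} → Attainable j s → SumOfWeights j s
attainable⇒sumOfWeights {j} none = (j ∷ 0 ∷ 0 ∷ 0 ∷ []) , +-identityʳ j , cong (_+ 0) (*-zeroʳ j)
attainable⇒sumOfWeights {j} {s} (between 2≤s s≤4j) = interval-sumOfWeights j s 2≤s s≤4j

representable⇒attainable : ∀ {a n} → Representable (generators a) n →
                           ∃[ j ] ∃[ s ] Attainable j s × j * a + s ≡ n
representable⇒attainable {a} (xs , refl) =
  sum xs , xs · weights , ·weights-attainable xs , sym (·-generators a xs)

attainable⇒representable : ∀ {a j s} → Attainable j s → Representable (generators a) (j * a + s)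
attainable⇒representable {a} att with xs , refl , refl ← attainable⇒sumOfWeights att =
  xs , ·-generators a xs

quotient-split : ∀ {a j s q r} → j * a + s ≡ q * a + r → r < a → ∃[ d ] j + d ≡ q × s ≡ d * a + r
quotient-split {a} {j} {s} {q} {r} eq r<a with <-≤-connex q j
... | inj₁ q<j with e , refl ← m≤n⇒∃[o]m+o≡n q<j = contradiction a≤r (<⇒≱ r<a)
  where
  regroup : ∀ q e a s → (suc q + e) * a + s ≡ q * a + (a + (e * a + s))
  regroup = solve-∀
  a≤r : a ≤ r
  a≤r = subst (a ≤_) (+-cancelˡ-≡ (q * a) _ _ (trans (sym (regroup q e a s)) eq)) (m≤m+n a _)
... | inj₂ j≤q with d , refl ← m≤n⇒∃[o]m+o≡n j≤q =
  d , refl , +-cancelˡ-≡ (j * a) _ _ (begin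
    j * a + s            ≡⟨ eq ⟩
    (j + d) * a + r      ≡⟨ cong (_+ r) (*-distribʳ-+ a j d) ⟩
    j * a + d * a + r    ≡⟨ +-assoc (j * a) (d * a) r ⟩
    j * a + (d * a + r)  ∎)
  where open ≡-Reasoning

data Gap (a q : ℕ) : ℕ → Set where
  above : ∀ {r} → 4 * q < r → Gap a q r
  one   : 4 * q ≤ a + 4 → Gap a q 1

gap⇒1≤ : ∀ {a q r} → Gap a q r → 1 ≤ r
gap⇒1≤ (above 4q<r) = ≤-trans (s≤s z≤n) 4q<r
gap⇒1≤ (one _) = ≤-refl

gap⇒¬representable : ∀ {a q r} → r < a → Gap a q r → ¬ Representable (generators a) (q * a + r)
gap⇒¬representable {a} {q} {r} r<a gap rep
  with j , s , att , eq ← representable⇒attainable rep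
  with d , refl , refl ← quotient-split {a} {j} {s} {q} {r} eq r<a = excluded d att gap
  where
  open ≤-Reasoning
  excluded : ∀ d → Attainable j (d * a + r) → Gap a (j + d) r → ⊥
  excluded d att (above 4q<r) = <⇒≱ 4q<r (begin
    r           ≤⟨ m≤n+m r (d * a) ⟩
    d * a + r   ≤⟨ attainable⇒≤ att ⟩
    4 * j       ≤⟨ *-monoʳ-≤ 4 (m≤m+n j d) ⟩
    4 * (j + d) ∎)
  excluded zero att (one _) = attainable⇒≢1 att refl
  excluded (suc d) att (one 4q≤a+4) = <⇒≱ (begin-strict
    4 * j                 ≤⟨ 4j≤a ⟩
    a                     <⟨ n<1+n a ⟩
    suc a                 ≡⟨ +-comm 1 a ⟩
    a + 1                 ≤⟨ +-monoˡ-≤ 1 (m≤m+n a (d * a)) ⟩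
    suc d * a + 1 ∎) (attainable⇒≤ att)
    where
    4j≤a : 4 * j ≤ a
    4j≤a = +-cancelʳ-≤ 4 (4 * j) a (begin
      4 * j + 4        ≡⟨ *-distribˡ-+ 4 j 1 ⟨
      4 * (j + 1)      ≤⟨ *-monoʳ-≤ 4 (+-monoʳ-≤ j (s≤s z≤n)) ⟩
      4 * (j + suc d)  ≤⟨ 4q≤a+4 ⟩
      a + 4            ∎)

gap⇒4q≤a+4 : ∀ {a q r} → r < a → Gap a q r → 4 * q ≤ a + 4
gap⇒4q≤a+4 {a} r<a (above 4q<r) = ≤-trans (<⇒≤ (<-trans 4q<r r<a)) (m≤m+n a 4)
gap⇒4q≤a+4 _ (one 4q≤a+4) = 4q≤a+4

¬representable⇒gap : ∀ {a q r} → r < a → ¬ Representable (generators a) (q * a + r) → Gap a q r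
¬representable⇒gap {a} {q} {zero} _ ¬rep = contradiction (attainable⇒representable {a} {q} none) ¬rep
¬representable⇒gap {a} {zero} {suc zero} _ _ = one z≤n
¬representable⇒gap {a} {suc q} {suc zero} 1<a ¬rep with 4 * suc q ≤? a + 4
... | yes 4q≤a+4 = one 4q≤a+4
... | no 4q≰a+4 = contradiction (subst (Representable _) (regroup q a) fromBelow) ¬rep
  where
  regroup : ∀ q a → q * a + (a + 1) ≡ suc q * a + 1
  regroup = solve-∀
  a+1≤4q : a + 1 ≤ 4 * q
  a+1≤4q = +-cancelʳ-≤ 4 (a + 1) (4 * q) (begin
    a + 1 + 4    ≡⟨ cong (_+ 4) (+-comm a 1) ⟩
    suc (a + 4)  ≤⟨ ≰⇒> 4q≰a+4 ⟩
    4 * suc q    ≡⟨ *-suc 4 q ⟩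
    4 + 4 * q    ≡⟨ +-comm 4 (4 * q) ⟩
    4 * q + 4    ∎)
    where open ≤-Reasoning
  fromBelow : Representable (generators a) (q * a + (a + 1))
  fromBelow = attainable⇒representable {a} {q} (between (≤-trans 1<a (m≤m+n a 1)) a+1≤4q)
¬representable⇒gap {a} {q} {suc (suc r)} _ ¬rep with 4 * q <? suc (suc r)
... | yes 4q<r = above 4q<r
... | no 4q≮r =
  contradiction (attainable⇒representable {a} {q} (between (s≤s (s≤s z≤n)) (≮⇒≥ 4q≮r))) ¬rep

m<n∸o⇒o+m<n : ∀ {m n o} → m < n ∸ o → o + m < n
m<n∸o⇒o+m<n {m} {n} {o} m<n∸o = subst (o + m <_) (m+[n∸m]≡n o≤n) (+-monoʳ-< o m<n∸o)
  where
  o≤n : o ≤ n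
  o≤n = <⇒≤ (m∸n≢0⇒n<m (m<n⇒n≢0 m<n∸o))

o+m<n⇒m<n∸o : ∀ {m n o} → o + m < n → m < n ∸ o
o+m<n⇒m<n∸o {m} {n} {o} o+m<n = subst (_< n ∸ o) (m+n∸m≡n o m) (∸-monoˡ-< o+m<n (m≤m+n o m))

m∸[1+n]≡m∸n∸1 : ∀ m n → m ∸ suc n ≡ m ∸ n ∸ 1
m∸[1+n]≡m∸n∸1 m n = trans (cong (m ∸_) (+-comm 1 n)) (sym (∸-+-assoc m n 1))

m∸4[1+n]≡m∸4n∸4 : ∀ m n → m ∸ 4 * suc n ≡ m ∸ 4 * n ∸ 4
m∸4[1+n]≡m∸4n∸4 m n = trans (cong (m ∸_) (trans (*-suc 4 n) (+-comm 4 (4 * n)))) (sym (∸-+-assoc m (4 * n) 4))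

-- gapSum b f = Σ_{i<f} (b ∸ (4i + 1)), the number of residues 4i < r < b over the levels i < f.

gapSum : ℕ → ℕ → ℕ
gapSum b zero = 0
gapSum b (suc f) = b ∸ 1 + gapSum (b ∸ 4) f

module Gaps (a m : ℕ) (2≤a : 2 ≤ a) (4m≤a : m * 4 ≤ a) (a<4[1+m] : a < suc m * 4) where

  private instance
    a≢0 : NonZero a
    a≢0 = >-nonZero (≤-trans (s≤s z≤n) 2≤a)

  ≤1+m⇒4q≤a+4 : ∀ {q} → q ≤ suc m → 4 * q ≤ a + 4
  ≤1+m⇒4q≤a+4 {q} q≤1+m = begin
    4 * q      ≤⟨ *-monoʳ-≤ 4 q≤1+m ⟩
    4 * suc m  ≡⟨ *-comm 4 (suc m) ⟩
    4 + m * 4  ≡⟨ +-comm 4 (m * 4) ⟩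
    m * 4 + 4  ≤⟨ +-monoˡ-≤ 4 4m≤a ⟩
    a + 4      ∎
    where open ≤-Reasoning

  4q≤a+4⇒≤1+m : ∀ {q} → 4 * q ≤ a + 4 → q ≤ suc m
  4q≤a+4⇒≤1+m {q} 4q≤a+4 = <⇒≤pred (*-cancelˡ-< 4 q (2 + m) (begin-strict
    4 * q          ≤⟨ 4q≤a+4 ⟩
    a + 4          <⟨ +-monoˡ-< 4 a<4[1+m] ⟩
    suc m * 4 + 4  ≡⟨ +-comm (suc m * 4) 4 ⟩
    (2 + m) * 4    ≡⟨ *-comm (2 + m) 4 ⟩
    4 * (2 + m)    ∎))
    where open ≤-Reasoning

  gapResidues : ℕ → List ℕ
  gapResidues zero = applyUpTo suc (a ∸ 1)
  gapResidues (suc q) = 1 ∷ applyUpTo (suc (4 * suc q) +_) (a ∸ suc (4 * suc q))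

  ∈-gapResidues⇒< : ∀ q {r} → r ∈ gapResidues q → r < a
  ∈-gapResidues⇒< zero r∈ with i , i<a∸1 , refl ← ∈-applyUpTo⁻ suc r∈ = m<n∸o⇒o+m<n i<a∸1
  ∈-gapResidues⇒< (suc q) (here refl) = 2≤a
  ∈-gapResidues⇒< (suc q) (there r∈) with i , i<a∸k , refl ← ∈-applyUpTo⁻ (suc (4 * suc q) +_) r∈ =
    m<n∸o⇒o+m<n i<a∸k

  ∈-gapResidues⇒gap : ∀ q {r} → q ≤ suc m → r ∈ gapResidues q → Gap a q r
  ∈-gapResidues⇒gap zero _ r∈ with i , _ , refl ← ∈-applyUpTo⁻ suc r∈ = above (s≤s z≤n)
  ∈-gapResidues⇒gap (suc q) q≤1+m (here refl) = one (≤1+m⇒4q≤a+4 q≤1+m)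
  ∈-gapResidues⇒gap (suc q) _ (there r∈) with i , _ , refl ← ∈-applyUpTo⁻ (suc (4 * suc q) +_) r∈ =
    above (s≤s (m≤m+n (4 * suc q) i))

  gap⇒∈-gapResidues : ∀ q {r} → r < a → Gap a q r → r ∈ gapResidues q
  gap⇒∈-gapResidues zero {zero} _ (above ())
  gap⇒∈-gapResidues zero {suc i} r<a _ = ∈-applyUpTo⁺ suc (o+m<n⇒m<n∸o r<a)
  gap⇒∈-gapResidues (suc q) r<a (one _) = here refl
  gap⇒∈-gapResidues (suc q) r<a (above 4q<r) with i , refl ← m≤n⇒∃[o]m+o≡n 4q<r =
    there (∈-applyUpTo⁺ (suc (4 * suc q) +_) (o+m<n⇒m<n∸o r<a))

  gapResidues-sorted : ∀ q → AllPairs _<_ (gapResidues q)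
  gapResidues-sorted zero = AllPairs.applyUpTo⁺₁ suc (a ∸ 1) (λ i<j _ → s≤s i<j)
  gapResidues-sorted (suc q) =
    All.applyUpTo⁺₂ _ _ (λ i → s≤s (s≤s z≤n)) ∷
    AllPairs.applyUpTo⁺₁ _ _ (λ i<j _ → +-monoʳ-< (suc (4 * suc q)) i<j)

  block : ℕ → List ℕ
  block q = map (q * a +_) (gapResidues q)

  blocks : ℕ → ℕ → List ℕ
  blocks q zero = []
  blocks q (suc f) = block q ++ blocks (suc q) f

  gaps : List ℕ
  gaps = blocks 0 (2 + m)

  ∈-blocks⁻ : ∀ q f {x} → x ∈ blocks q f →
              ∃[ p ] ∃[ r ] q ≤ p × p < q + f × r ∈ gapResidues p × p * a + r ≡ x
  ∈-blocks⁻ q (suc f) x∈ with ∈-++⁻ (block q) x∈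
  ... | inj₁ x∈block with r , r∈ , refl ← ∈-map⁻ (q * a +_) x∈block =
    q , r , ≤-refl , m<m+n q (s≤s z≤n) , r∈ , refl
  ... | inj₂ x∈later with p , r , q<p , p<q+1+f , r∈ , eq ← ∈-blocks⁻ (suc q) f x∈later =
    p , r , <⇒≤ q<p , subst (p <_) (sym (+-suc q f)) p<q+1+f , r∈ , eq

  ∈-blocks⁺ : ∀ q f {p r} → q ≤ p → p < q + f → r ∈ gapResidues p → p * a + r ∈ blocks q f
  ∈-blocks⁺ q zero q≤p p<q+0 _ = contradiction (subst (_ <_) (+-identityʳ q) p<q+0) (≤⇒≯ q≤p)
  ∈-blocks⁺ q (suc f) {p} q≤p p<q+1+f r∈ with q ≟ p
  ... | yes refl = ∈-++⁺ˡ (∈-map⁺ (q * a +_) r∈)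
  ... | no q≢p =
    ∈-++⁺ʳ (block q) (∈-blocks⁺ (suc q) f (≤∧≢⇒< q≤p q≢p) (subst (p <_) (+-suc q f) p<q+1+f) r∈)

  ∈-block⇒< : ∀ q {x} → x ∈ block q → x < suc q * a
  ∈-block⇒< q x∈ with r , r∈ , refl ← ∈-map⁻ (q * a +_) x∈ =
    subst (q * a + r <_) (+-comm (q * a) a) (+-monoʳ-< (q * a) (∈-gapResidues⇒< q r∈))

  ∈-blocks⇒≥ : ∀ q f {x} → x ∈ blocks q f → q * a ≤ x
  ∈-blocks⇒≥ q f x∈ with p , r , q≤p , _ , _ , refl ← ∈-blocks⁻ q f x∈ =
    ≤-trans (*-monoˡ-≤ a q≤p) (m≤m+n (p * a) r)

  blocks-sorted : ∀ q f → AllPairs _<_ (blocks q f)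
  blocks-sorted q zero = []
  blocks-sorted q (suc f) =
    AllPairs.++⁺ (AllPairs.map⁺ (AllPairs.map (+-monoʳ-< (q * a)) (gapResidues-sorted q)))
                 (blocks-sorted (suc q) f)
                 (All.tabulate λ x∈ → All.tabulate λ y∈ →
                    <-≤-trans (∈-block⇒< q x∈) (∈-blocks⇒≥ (suc q) f y∈))

  length-block : ∀ q → length (block (suc q)) ≡ suc (a ∸ 4 * suc q ∸ 1)
  length-block q = begin
    length (block (suc q))
      ≡⟨ length-map (suc q * a +_) (gapResidues (suc q)) ⟩
    suc (length (applyUpTo (suc (4 * suc q) +_) (a ∸ suc (4 * suc q))))
      ≡⟨ cong suc (length-applyUpTo (suc (4 * suc q) +_) (a ∸ suc (4 * suc q))) ⟩
    suc (a ∸ suc (4 * suc q))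
      ≡⟨ cong suc (m∸[1+n]≡m∸n∸1 a (4 * suc q)) ⟩
    suc (a ∸ 4 * suc q ∸ 1) ∎
    where open ≡-Reasoning

  length-blocks : ∀ q f → length (blocks (suc q) f) ≡ f + gapSum (a ∸ 4 * suc q) f
  length-blocks q zero = refl
  length-blocks q (suc f) = begin
    length (block (suc q) ++ blocks (2 + q) f)          ≡⟨ length-++ (block (suc q)) ⟩
    length (block (suc q)) + length (blocks (2 + q) f)  ≡⟨ cong₂ _+_ (length-block q) (length-blocks (suc q) f) ⟩
    suc (b ∸ 1) + (f + gapSum (a ∸ 4 * suc (suc q)) f)  ≡⟨ cong (λ c → suc (b ∸ 1) + (f + gapSum c f)) b∸4 ⟩
    suc (b ∸ 1) + (f + gapSum (b ∸ 4) f)                ≡⟨ regroup (b ∸ 1) f (gapSum (b ∸ 4) f) ⟩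
    suc f + (b ∸ 1 + gapSum (b ∸ 4) f)                  ∎
    where
    open ≡-Reasoning
    b : ℕ
    b = a ∸ 4 * suc q
    b∸4 : a ∸ 4 * suc (suc q) ≡ b ∸ 4
    b∸4 = m∸4[1+n]≡m∸4n∸4 a (suc q)
    regroup : ∀ x f y → suc x + (f + y) ≡ suc f + (x + y)
    regroup = solve-∀

  length-gaps : length gaps ≡ suc m + gapSum a (2 + m)
  length-gaps = begin
    length (block 0 ++ blocks 1 (suc m))          ≡⟨ length-++ (block 0) ⟩
    length (block 0) + length (blocks 1 (suc m))  ≡⟨ cong₂ _+_ length-block0 (length-blocks 0 (suc m)) ⟩
    a ∸ 1 + (suc m + gapSum (a ∸ 4) (suc m))      ≡⟨ regroup (a ∸ 1) (suc m) (gapSum (a ∸ 4) (suc m)) ⟩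
    suc m + (a ∸ 1 + gapSum (a ∸ 4) (suc m))      ∎
    where
    open ≡-Reasoning
    length-block0 : length (block 0) ≡ a ∸ 1
    length-block0 = trans (length-map (0 * a +_) (gapResidues 0)) (length-applyUpTo suc (a ∸ 1))
    regroup : ∀ x y z → x + (y + z) ≡ y + (x + z)
    regroup = solve-∀

  gaps-sound : ∀ {n} → n ∈ gaps → 1 ≤ n × ¬ Representable (generators a) n
  gaps-sound n∈ with q , r , _ , q<2+m , r∈ , refl ← ∈-blocks⁻ 0 (2 + m) n∈ =
    ≤-trans (gap⇒1≤ gap) (m≤n+m r (q * a)) , gap⇒¬representable (∈-gapResidues⇒< q r∈) gap
    where
    gap : Gap a q r
    gap = ∈-gapResidues⇒gap q (<⇒≤pred q<2+m) r∈

  gaps-complete : ∀ n → ¬ Representable (generators a) n → n ∈ gaps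
  gaps-complete n ¬rep =
    subst (_∈ gaps) (sym n≡) (∈-blocks⁺ 0 (2 + m) {q} z≤n q<2+m (gap⇒∈-gapResidues q r<a gap))
    where
    q r : ℕ
    q = n / a
    r = n % a
    n≡ : n ≡ q * a + r
    n≡ = trans (m≡m%n+[m/n]*n n a) (+-comm r (q * a))
    r<a : r < a
    r<a = m%n<n n a
    gap : Gap a q r
    gap = ¬representable⇒gap r<a (¬rep ∘ subst (Representable _) (sym n≡))
    q<2+m : q < 2 + m
    q<2+m = s≤s (4q≤a+4⇒≤1+m (gap⇒4q≤a+4 r<a gap))

  sylvesterNumber : SylvesterNumberIs (generators a) (suc m + gapSum a (2 + m))
  sylvesterNumber = gaps , AllPairs.map <⇒≢ (blocks-sorted 0 (2 + m)) , length-gaps ,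
                    λ n → gaps-sound , gaps-complete n ∘ proj₂

gapSum-4m : ∀ m → gapSum (m * 4 + 0) (2 + m) ≡ m * m * 2 + m
gapSum-4m zero = refl
gapSum-4m (suc m) = trans (cong (3 + (m * 4 + 0) +_) (gapSum-4m m)) (step m)
  where
  step : ∀ m → 3 + (m * 4 + 0) + (m * m * 2 + m) ≡ suc m * suc m * 2 + suc m
  step = solve-∀

gapSum-4m+1+k : ∀ k → k ≤ 2 → ∀ m → gapSum (m * 4 + suc k) (2 + m) ≡ m * (m + 1) * 2 + (m + 1) * k
gapSum-4m+1+k k k≤2 zero = cong (λ b → k + (b ∸ 1 + 0)) (m≤n⇒m∸n≡0 (s≤s (m≤n⇒m≤1+n k≤2)))
gapSum-4m+1+k k k≤2 (suc m) = trans (cong (3 + (m * 4 + suc k) +_) (gapSum-4m+1+k k k≤2 m)) (step m k)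
  where
  step : ∀ m k → 3 + (m * 4 + suc k) + (m * (m + 1) * 2 + (m + 1) * k) ≡ suc m * (suc m + 1) * 2 + (suc m + 1) * k
  step = solve-∀

exact-/8 : ∀ {n} t → n ≡ t * 8 → t ≡ n / 8
exact-/8 t refl = sym (m*n/n≡m t 8)

count-4m : ∀ m → suc m + gapSum (m * 4 + 0) (2 + m) ≡ ((m * 4 + 0) * (m * 4 + 0) + 4 * (m * 4 + 0) + 8) / 8
count-4m m rewrite gapSum-4m m = exact-/8 _ (poly m)
  where
  poly : ∀ m → (m * 4 + 0) * (m * 4 + 0) + 4 * (m * 4 + 0) + 8 ≡ (suc m + (m * m * 2 + m)) * 8
  poly = solve-∀

count-4m+1 : ∀ m → suc m + gapSum (m * 4 + 1) (2 + m) ≡ ((m * 4 + 1) * (m * 4 + 1) + 4 * (m * 4 + 1) + 3) / 8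
count-4m+1 m rewrite gapSum-4m+1+k 0 z≤n m = exact-/8 _ (poly m)
  where
  poly : ∀ m → (m * 4 + 1) * (m * 4 + 1) + 4 * (m * 4 + 1) + 3 ≡ (suc m + (m * (m + 1) * 2 + (m + 1) * 0)) * 8
  poly = solve-∀

count-4m+2 : ∀ m → suc m + gapSum (m * 4 + 2) (2 + m) ≡ ((m * 4 + 2) * (m * 4 + 2) + 4 * (m * 4 + 2) + 4) / 8
count-4m+2 m rewrite gapSum-4m+1+k 1 (s≤s z≤n) m = exact-/8 _ (poly m)
  where
  poly : ∀ m → (m * 4 + 2) * (m * 4 + 2) + 4 * (m * 4 + 2) + 4 ≡ (suc m + (m * (m + 1) * 2 + (m + 1) * 1)) * 8
  poly = solve-∀

count-4m+3 : ∀ m → suc m + gapSum (m * 4 + 3) (2 + m) ≡ ((m * 4 + 3) * (m * 4 + 3) + 4 * (m * 4 + 3) + 3) / 8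
count-4m+3 m rewrite gapSum-4m+1+k 2 (s≤s (s≤s z≤n)) m = exact-/8 _ (poly m)
  where
  poly : ∀ m → (m * 4 + 3) * (m * 4 + 3) + 4 * (m * 4 + 3) + 3 ≡ (suc m + (m * (m + 1) * 2 + (m + 1) * 2)) * 8
  poly = solve-∀

corollary3 : (a : ℕ) → 2 ≤ a →
    (a % 4 ≡ 0 → SylvesterNumberIs (a ∷ a + 2 ∷ a + 3 ∷ a + 4 ∷ []) ((a * a + 4 * a + 8) / 8)) ×
    (a % 4 ≡ 1 → SylvesterNumberIs (a ∷ a + 2 ∷ a + 3 ∷ a + 4 ∷ []) ((a * a + 4 * a + 3) / 8)) ×
    (a % 4 ≡ 2 → SylvesterNumberIs (a ∷ a + 2 ∷ a + 3 ∷ a + 4 ∷ []) ((a * a + 4 * a + 4) / 8)) ×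
    (a % 4 ≡ 3 → SylvesterNumberIs (a ∷ a + 2 ∷ a + 3 ∷ a + 4 ∷ []) ((a * a + 4 * a + 3) / 8))
corollary3 a 2≤a =
  byResidue (λ x → (x * x + 4 * x + 8) / 8) count-4m ,
  byResidue (λ x → (x * x + 4 * x + 3) / 8) count-4m+1 ,
  byResidue (λ x → (x * x + 4 * x + 4) / 8) count-4m+2 ,
  byResidue (λ x → (x * x + 4 * x + 3) / 8) count-4m+3
  where
  m : ℕ
  m = a / 4
  a≡4m+a%4 : a ≡ m * 4 + a % 4
  a≡4m+a%4 = trans (m≡m%n+[m/n]*n a 4) (+-comm (a % 4) (m * 4))
  a<4[1+m] : a < suc m * 4
  a<4[1+m] = subst₂ _<_ (sym a≡4m+a%4) (+-comm (m * 4) 4) (+-monoʳ-< (m * 4) (m%n<n a 4))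
  byResidue : ∀ {c} (f : ℕ → ℕ) → (∀ m → suc m + gapSum (m * 4 + c) (2 + m) ≡ f (m * 4 + c)) →
              a % 4 ≡ c → SylvesterNumberIs (generators a) (f a)
  byResidue f count refl =
    subst (SylvesterNumberIs (generators a))
          (subst (λ x → suc m + gapSum x (2 + m) ≡ f x) (sym a≡4m+a%4) (count m))
          (Gaps.sylvesterNumber a m 2≤a (m/n*n≤m a 4) a<4[1+m])
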